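{- Let $A_2=\{231,321,4123,21534\}$. A permutation belongs to $\operatorname{Av}(A_2)$ if and only if it is of the form $\pi\oplus\sigma\oplus\tau$, where $\pi$ is an increasing permutation (possibly empty), $\sigma$ is either empty or equal to $312$, and $\tau$ is a Fibonacci permutation (possibly empty).
   Context: For a set $S$ of permutations, $\operatorname{Av}(S)$ is the set of all permutations avoiding every pattern in $S$ (in the classical sense: no subsequence is order isomorphic to the pattern). A Fibonacci permutation is a permutation in $\operatorname{Av}(231,312,321)$. For permutations $\pi$ of length $n$ and $\sigma$ of length $k$, $\pi\oplus\sigma$ is $\pi$ followed by $\sigma$ with every entry of $\sigma$ increased by $n$. -}

module Defs where

open import Data.Nat using (ℕ; zero; suc; _+_; _<_)
open import Data.List using (List; []; _∷_; _++_; map; length; upTo; lookup)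
open import Data.List.Relation.Binary.Sublist.Propositional using (_⊆_)
open import Data.List.Relation.Binary.Permutation.Propositional using (_↭_)
open import Data.List.Relation.Unary.All using (All)
open import Data.Product using (Σ; _×_; ∃)
open import Data.Sum using (_⊎_)
open import Data.Fin using (Fin; cast)
open import Relation.Binary.PropositionalEquality using (_≡_)
open import Relation.Nullary using (¬_)
open import Function.Bundles using (_⇔_)

-- A permutation of length n in one-line notation: a list that is a
-- rearrangement of [1, 2, ..., n].
Perm : Set
Perm = List ℕ

inc : ℕ → Perm
inc n = map suc (upTo n)

IsPerm : Perm → Set
IsPerm w = w ↭ inc (length w)

OrderIso : List ℕ → List ℕ → Set
OrderIso p s =
  Σ (length p ≡ length s) λ eq →
    (i j : Fin (length p)) →
      (lookup p i < lookup p j) ⇔ (lookup s (cast eq i) < lookup s (cast eq j))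

Contains : Perm → Perm → Set
Contains w p = ∃ λ s → (s ⊆ w) × OrderIso p s

Av : List Perm → Perm → Set
Av S w = All (λ p → ¬ Contains w p) S

_⊕_ : Perm → Perm → Perm
π ⊕ σ = π ++ map (length π +_) σ

infixl 6 _⊕_

p231 p312 p321 p4123 p21534 : Perm
p231 = 2 ∷ 3 ∷ 1 ∷ []
p312 = 3 ∷ 1 ∷ 2 ∷ []
p321 = 3 ∷ 2 ∷ 1 ∷ []
p4123 = 4 ∷ 1 ∷ 2 ∷ 3 ∷ []
p21534 = 2 ∷ 1 ∷ 5 ∷ 3 ∷ 4 ∷ []

A₂ : List Perm
A₂ = p231 ∷ p321 ∷ p4123 ∷ p21534 ∷ []

Fibonacci : Perm → Set
Fibonacci τ = IsPerm τ × Av (p231 ∷ p312 ∷ p321 ∷ []) τ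

-- Reading w from the left: while w starts with its least entry 1 it is 1 ⊕ w′, which builds
-- the increasing prefix. Otherwise w starts with some x ≥ 2 followed by 1, for with any other
-- second entry y, x y 1 is a 231 or a 321. If x = 2 then w = 21 ⊕ τ′ is Fibonacci: an
-- occurrence of 312 cannot use the 2, which has only one smaller entry, and one inside τ′
-- would make a 21534 together with 21. If x ≥ 3 the same argument puts 2 in third position,
-- then x = 3 since x123 would be a 4123, and the rest τ avoids 312 since 31τ would contain a
-- 21534. Conversely, no pattern of A₂ starts with its least entry, so prepending a new minimum
-- creates none; a Fibonacci permutation avoids 4123 and 21534 because both contain 312; and an
-- occurrence meeting the block 312 of 312 ⊕ τ can only start at its 3, which rules each
-- pattern out directly.
module Submission where

open import Defs
open import Data.Nat using (ℕ; zero; suc; _+_; _∸_; _<_; _≤_; z≤n; s≤s; z<s; s<s; _<?_; _≤?_)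
open import Data.Nat.Properties
  using ( <-cmp; <-irrefl; <-asym; <-trans; <⇒≱; <⇒≤; ≰⇒>; ≮⇒≥; ≤∧≢⇒<; ≤-refl; ≤-trans; ≤-antisym
        ; +-assoc; +-monoʳ-<; m<m+n; m≤m+n; m+n∸m≡n; m+[n∸m]≡n; suc-injective)
open import Data.List using (List; []; _∷_; _++_; map; length; lookup; upTo)
open import Data.List.Properties
  using ( length-map; length-upTo; length-++; map-upTo; map-++; map-∘; map-cong; map-id; map-id-local
        ; ++-assoc)
open import Data.List.Membership.Propositional using (_∈_)
open import Data.List.Membership.Propositional.Properties using (∈-lookup; ∈-upTo⁺; ∈-upTo⁻; ∈-map⁺; ∈-map⁻)
open import Data.List.Relation.Binary.Sublist.Propositional using (_⊆_; []; _∷_; _∷ʳ_; ⊆-refl; ⊆-trans; from∈)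
open import Data.List.Relation.Binary.Sublist.Propositional.Properties using (All-resp-⊆; ∷ˡ⁻; map⁺)
open import Data.List.Relation.Binary.Permutation.Propositional
  using (_↭_; ↭-refl; ↭-sym; ↭-trans; prep; swap; ↭⇒↭ₛ)
open import Data.List.Relation.Binary.Permutation.Propositional.Properties
  using (∈-resp-↭; All-resp-↭; drop-∷; ++⁺ʳ; ↭-length; ¬x∷xs↭[])
import Data.List.Relation.Binary.Permutation.Propositional.Properties as ↭
import Data.List.Relation.Binary.Permutation.Setoid.Properties as ↭ₛ
open import Data.List.Relation.Unary.All as All using (All; []; _∷_; all?)
import Data.List.Relation.Unary.All.Properties as All
open import Data.List.Relation.Unary.Any as Any using (Any; here; there)
open import Data.List.Relation.Unary.Any.Properties using (lookup-index)
open import Data.List.Relation.Unary.AllPairs using (_∷_)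
open import Data.List.Relation.Unary.Unique.Propositional using (Unique)
import Data.List.Relation.Unary.Unique.Propositional.Properties as Unique
open import Data.Vec as Vec using (Vec; []; _∷_; toList; fromList)
open import Data.Vec.Properties using (toList-cast; toList∘fromList)
open import Data.Vec.Relation.Unary.All as VecAll using (_∷_)
open import Data.Vec.Relation.Unary.Linked using (Linked; [-]; _∷_)
open import Data.Vec.Relation.Unary.Linked.Properties using (Linked⇒All)
open import Data.Product using (Σ; ∃; _×_; _,_; proj₁; proj₂)
open import Data.Sum using (_⊎_; inj₁; inj₂)
open import Data.Empty using (⊥; ⊥-elim)
open import Data.Fin using (cast; #_) renaming (zero to fzero; suc to fsuc)
open import Data.Fin.Properties using (cast-trans; cast-involutive)
open import Relation.Binary.Core using (_Preserves_⟶_)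
open import Relation.Binary.Definitions using (tri<; tri≈; tri>)
open import Relation.Binary.PropositionalEquality
  using (_≡_; _≢_; refl; sym; trans; cong; subst; subst₂; setoid; module ≡-Reasoning)
open import Relation.Nullary using (¬_; Dec; yes; no)
open import Relation.Nullary.Decidable using (True; toWitness; _×-dec_)
open import Function using (_∘_)
open import Function.Bundles using (_⇔_; mk⇔; Equivalence)
open import Function.Construct.Symmetry using (⇔-sym)
open import Function.Construct.Composition using (_⇔-∘_)

private
  variable
    n x y : ℕ
    p r s t u v w τ : List ℕ

OrderIso-sym : OrderIso p s → OrderIso s p
OrderIso-sym {p} {s} (eq , iso) = sym eq , λ i j →
  subst₂ (λ i′ j′ → (lookup s i′ < lookup s j′) ⇔ (lookup p (cast (sym eq) i) < lookup p (cast (sym eq) j)))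
         (cast-involutive eq (sym eq) i) (cast-involutive eq (sym eq) j)
         (⇔-sym (iso (cast (sym eq) i) (cast (sym eq) j)))

OrderIso-trans : OrderIso p s → OrderIso s t → OrderIso p t
OrderIso-trans {p} {s} {t} (eq₁ , iso₁) (eq₂ , iso₂) = trans eq₁ eq₂ , λ i j →
  subst₂ (λ i′ j′ → (lookup s (cast eq₁ i) < lookup s (cast eq₁ j)) ⇔ (lookup t i′ < lookup t j′))
         (cast-trans eq₁ eq₂ i) (cast-trans eq₁ eq₂ j)
         (iso₂ (cast eq₁ i) (cast eq₁ j))
  ⇔-∘ iso₁ i j

lookup-map : ∀ (g : ℕ → ℕ) xs .(eq : length xs ≡ length (map g xs)) i →
             lookup (map g xs) (cast eq i) ≡ g (lookup xs i)
lookup-map g (x ∷ xs) eq fzero    = refl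
lookup-map g (x ∷ xs) eq (fsuc i) = lookup-map g xs _ i

map-orderIso : ∀ (g : ℕ → ℕ) s → (∀ {x y} → x ∈ s → y ∈ s → x < y → g x < g y) →
               OrderIso s (map g s)
map-orderIso g s mono = eq , λ i j →
  subst₂ (λ a b → (lookup s i < lookup s j) ⇔ (a < b))
         (sym (lookup-map g s eq i)) (sym (lookup-map g s eq j))
         (mk⇔ (mono (∈-lookup i) (∈-lookup j)) (reflect i j))
  where
  eq : length s ≡ length (map g s)
  eq = sym (length-map g s)
  reflect : ∀ i j → g (lookup s i) < g (lookup s j) → lookup s i < lookup s j
  reflect i j gi<gj with <-cmp (lookup s i) (lookup s j)
  ... | tri< si<sj _ _ = si<sj
  ... | tri≈ _ si≡sj _ = ⊥-elim (<-irrefl (cong g si≡sj) gi<gj)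
  ... | tri> _ _ sj<si = ⊥-elim (<-asym gi<gj (mono (∈-lookup j) (∈-lookup i) sj<si))

Contains-resp-⊆ : v ⊆ w → Contains v p → Contains w p
Contains-resp-⊆ v⊆w (s , s⊆v , iso) = s , ⊆-trans s⊆v v⊆w , iso

Av-resp-⊇ : ∀ {S} → v ⊆ w → Av S w → Av S v
Av-resp-⊇ v⊆w = All.map (λ {p} ¬c c → ¬c (Contains-resp-⊆ {p = p} v⊆w c))

⊆-map⁻ : ∀ (f : ℕ → ℕ) v → s ⊆ map f v → ∃ λ s′ → s ≡ map f s′ × s′ ⊆ v
⊆-map⁻ f []      []          = [] , refl , []
⊆-map⁻ f (x ∷ v) (_ ∷ʳ s⊆v)  with s′ , refl , s′⊆v ← ⊆-map⁻ f v s⊆v = s′ , refl , x ∷ʳ s′⊆v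
⊆-map⁻ f (x ∷ v) (refl ∷ s⊆v) with s′ , refl , s′⊆v ← ⊆-map⁻ f v s⊆v = x ∷ s′ , refl , refl ∷ s′⊆v

module _ (f : ℕ → ℕ) (f-mono : f Preserves _<_ ⟶ _<_) where

  private
    f-orderIso : ∀ s → OrderIso s (map f s)
    f-orderIso s = map-orderIso f s (λ _ _ → f-mono)

  Contains-map⁺ : Contains v p → Contains (map f v) p
  Contains-map⁺ {p = p} (s , s⊆v , iso) =
    map f s , map⁺ f s⊆v , OrderIso-trans {p} {s} {map f s} iso (f-orderIso s)

  Contains-map⁻ : Contains (map f v) p → Contains v p
  Contains-map⁻ {v} {p} (s , s⊆fv , iso) with s′ , refl , s′⊆v ← ⊆-map⁻ f v s⊆fv =
    s′ , s′⊆v , OrderIso-trans {p} {map f s′} {s′} iso (OrderIso-sym {s′} {map f s′} (f-orderIso s′))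

  Av-map⁺ : ∀ {S} → Av S v → Av S (map f v)
  Av-map⁺ = All.map (λ {p} ¬c c → ¬c (Contains-map⁻ {p = p} c))

  Av-map⁻ : ∀ {S} → Av S (map f v) → Av S v
  Av-map⁻ = All.map (λ {p} ¬c c → ¬c (Contains-map⁺ {p = p} c))

-- An occurrence of x ∷ q using the new first entry m would put a later entry below m.
prepend-below : ∀ {m x q} → All (m ≤_) v → Any (_< x) q →
                ¬ Contains v (x ∷ q) → ¬ Contains (m ∷ v) (x ∷ q)
prepend-below m≤v below ¬c (s , m ∷ʳ s⊆v , iso) = ¬c (s , s⊆v , iso)
prepend-below m≤v below ¬c (m ∷ s , refl ∷ s⊆v , eq , iso) =
  <⇒≱ (Equivalence.to (iso (fsuc (Any.index below)) fzero) (lookup-index below))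
      (All.lookup (All-resp-⊆ s⊆v m≤v) (∈-lookup _))

-- The x-th entry of vs, counting from 1 like pattern entries (0 when out of range).
nth : ∀ {k} → Vec ℕ k → ℕ → ℕ
nth (v ∷ _)  1             = v
nth (_ ∷ vs) (suc (suc x)) = nth vs (suc x)
nth _        _             = 0

All-nth : ∀ {P : ℕ → Set} {k} {vs : Vec ℕ k} {x} → VecAll.All P vs → 1 ≤ x → x ≤ k → P (nth vs x)
All-nth {x = 1}             (pv ∷ _)   _ _           = pv
All-nth {x = suc (suc x)}   (_ ∷ pvs) _ (s≤s x≤k)  = All-nth pvs (s≤s z≤n) x≤k

nth-< : ∀ {k} {vs : Vec ℕ k} {x y} → Linked _<_ vs → 1 ≤ x → x < y → y ≤ k → nth vs x < nth vs y
nth-< {x = 1} {suc (suc y)} (v<vs ∷ vs<) _ _ (s≤s y≤k) = All-nth (Linked⇒All <-trans v<vs vs<) (s≤s z≤n) y≤k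
nth-< {x = 1} {1} _ _ (s≤s ()) _
nth-< {x = 1} {suc (suc y)} [-] _ _ (s≤s ())
nth-< {x = suc (suc x)} {suc (suc y)} (_ ∷ vs<) _ (s≤s x<y) (s≤s y≤k) = nth-< vs< (s≤s z≤n) x<y y≤k

InRange : ℕ → ℕ → Set
InRange k x = 1 ≤ x × x ≤ k

inRange? : ∀ k x → Dec (InRange k x)
inRange? k x = (1 ≤? x) ×-dec (x ≤? k)

-- An occurrence of p in w, given by its values v₁ < ⋯ < vₖ: the pattern entry x is played by v_x.
Occurrence : Perm → Perm → Set
Occurrence p w = Σ (Vec ℕ (length p)) λ vs → Linked _<_ vs × map (nth vs) p ⊆ w

occurrence⇒contains : {inRange : True (all? (inRange? (length p)) p)} →
                      Occurrence p w → Contains w p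
occurrence⇒contains {p} {inRange = inRange} (vs , vs< , embedding) =
  map (nth vs) p , embedding , map-orderIso (nth vs) p monotone
  where
  monotone : ∀ {x y} → x ∈ p → y ∈ p → x < y → nth vs x < nth vs y
  monotone x∈p y∈p x<y =
    nth-< vs< (proj₁ (All.lookup (toWitness inRange) x∈p)) x<y (proj₂ (All.lookup (toWitness inRange) y∈p))

vectorise : Contains w p → Σ (Vec ℕ (length p)) λ s → toList s ⊆ w × OrderIso p (toList s)
vectorise {w} {p} (s , s⊆w , iso) =
  s′ , subst (λ t → t ⊆ w × OrderIso p t) (sym toList-s′) (s⊆w , iso)
  where
  s′ : Vec ℕ (length p)
  s′ = Vec.cast (sym (proj₁ iso)) (fromList s)
  toList-s′ : toList s′ ≡ s
  toList-s′ = trans (toList-cast _ (fromList s)) (toList∘fromList s)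

ascend : ∀ {s} (iso : OrderIso p s) i j → {True (lookup p i <? lookup p j)} →
         lookup s (cast (proj₁ iso) i) < lookup s (cast (proj₁ iso) j)
ascend (_ , iso) i j {p<} = Equivalence.to (iso i j) (toWitness p<)

occurrence231 : Contains w p231 → Occurrence p231 w
occurrence231 occ with a ∷ b ∷ c ∷ [] , sub , iso ← vectorise occ =
  c ∷ a ∷ b ∷ [] , ascend iso (# 2) (# 0) ∷ ascend iso (# 0) (# 1) ∷ [-] , sub

occurrence321 : Contains w p321 → Occurrence p321 w
occurrence321 occ with a ∷ b ∷ c ∷ [] , sub , iso ← vectorise occ =
  c ∷ b ∷ a ∷ [] , ascend iso (# 2) (# 1) ∷ ascend iso (# 1) (# 0) ∷ [-] , sub

occurrence312 : Contains w p312 → Occurrence p312 w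
occurrence312 occ with a ∷ b ∷ c ∷ [] , sub , iso ← vectorise occ =
  b ∷ c ∷ a ∷ [] , ascend iso (# 1) (# 2) ∷ ascend iso (# 2) (# 0) ∷ [-] , sub

occurrence4123 : Contains w p4123 → Occurrence p4123 w
occurrence4123 occ with a ∷ b ∷ c ∷ d ∷ [] , sub , iso ← vectorise occ =
  b ∷ c ∷ d ∷ a ∷ [] ,
  ascend iso (# 1) (# 2) ∷ ascend iso (# 2) (# 3) ∷ ascend iso (# 3) (# 0) ∷ [-] , sub

occurrence21534 : Contains w p21534 → Occurrence p21534 w
occurrence21534 occ with a ∷ b ∷ c ∷ d ∷ e ∷ [] , sub , iso ← vectorise occ =
  b ∷ a ∷ d ∷ e ∷ c ∷ [] ,
  ascend iso (# 1) (# 0) ∷ ascend iso (# 0) (# 3) ∷ ascend iso (# 3) (# 4) ∷ ascend iso (# 4) (# 2) ∷ [-] ,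
  sub

length-inc : ∀ n → length (inc n) ≡ n
length-inc n = trans (length-map suc (upTo n)) (length-upTo n)

length-⊕ : ∀ α β → length (α ⊕ β) ≡ length α + length β
length-⊕ α β = trans (length-++ α) (cong (length α +_) (length-map _ β))

⊕-identityˡ : ∀ α → [] ⊕ α ≡ α
⊕-identityˡ = map-id

⊕-assoc : ∀ α β γ → α ⊕ β ⊕ γ ≡ α ⊕ (β ⊕ γ)
⊕-assoc α β γ = begin
  (α ++ map (a +_) β) ++ map (length (α ⊕ β) +_) γ  ≡⟨ ++-assoc α _ _ ⟩
  α ++ map (a +_) β ++ map (length (α ⊕ β) +_) γ
    ≡⟨ cong (λ m → α ++ map (a +_) β ++ map (m +_) γ) (length-⊕ α β) ⟩
  α ++ map (a +_) β ++ map (a + length β +_) γ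
    ≡⟨ cong (λ l → α ++ map (a +_) β ++ l) (trans (map-cong (+-assoc a (length β)) γ) (map-∘ γ)) ⟩
  α ++ map (a +_) β ++ map (a +_) (map (length β +_) γ) ≡⟨ cong (α ++_) (sym (map-++ (a +_) β _)) ⟩
  α ⊕ (β ⊕ γ)                                        ∎
  where
  open ≡-Reasoning
  a : ℕ
  a = length α

inc-suc : ∀ n → inc (suc n) ≡ inc 1 ⊕ inc n
inc-suc n = cong (λ l → 1 ∷ map suc l) (sym (map-upTo suc n))

inc-+ : ∀ k n → inc (k + n) ≡ inc k ⊕ inc n
inc-+ zero    n = sym (⊕-identityˡ (inc n))
inc-+ (suc k) n = begin
  inc (suc (k + n))        ≡⟨ inc-suc (k + n) ⟩
  inc 1 ⊕ inc (k + n)      ≡⟨ cong (inc 1 ⊕_) (inc-+ k n) ⟩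
  inc 1 ⊕ (inc k ⊕ inc n)  ≡⟨ sym (⊕-assoc (inc 1) (inc k) (inc n)) ⟩
  inc 1 ⊕ inc k ⊕ inc n    ≡⟨ cong (_⊕ inc n) (sym (inc-suc k)) ⟩
  inc (suc k) ⊕ inc n      ∎
  where open ≡-Reasoning

inc-suc-⊕ : ∀ k v → inc (suc k) ⊕ v ≡ inc 1 ⊕ (inc k ⊕ v)
inc-suc-⊕ k v = trans (cong (_⊕ v) (inc-suc k)) (⊕-assoc (inc 1) (inc k) v)

∈-inc⁺ : 1 ≤ x → x ≤ n → x ∈ inc n
∈-inc⁺ {suc x} _ x<n = ∈-map⁺ suc (∈-upTo⁺ x<n)

∈-inc⁻ : x ∈ inc n → InRange n x
∈-inc⁻ x∈ with y , y∈ , refl ← ∈-map⁻ suc x∈ = s≤s z≤n , ∈-upTo⁻ y∈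

Unique-inc : ∀ n → Unique (inc n)
Unique-inc n = Unique.map⁺ suc-injective (Unique.upTo⁺ n)

module _ (perm : w ↭ inc n) where

  perm-inRange : x ∈ w → InRange n x
  perm-inRange = ∈-inc⁻ ∘ ∈-resp-↭ perm

  perm-positive : All (1 ≤_) w
  perm-positive = All.tabulate (proj₁ ∘ perm-inRange)

  perm-downward : x ∈ w → 1 ≤ y → y ≤ x → y ∈ w
  perm-downward x∈w 1≤y y≤x =
    ∈-resp-↭ (↭-sym perm) (∈-inc⁺ 1≤y (≤-trans y≤x (proj₂ (perm-inRange x∈w))))

  perm-unique : Unique w
  perm-unique = ↭ₛ.Unique-resp-↭ (setoid ℕ) (↭⇒↭ₛ (↭-sym perm)) (Unique-inc n)

  perm-isPerm : IsPerm w
  perm-isPerm = subst (λ m → w ↭ inc m) (sym (trans (↭-length perm) (length-inc n))) perm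

++-cancelˡ : ∀ u → u ++ r ↭ u ++ w → r ↭ w
++-cancelˡ []      p = p
++-cancelˡ (x ∷ u) p = ++-cancelˡ u (drop-∷ p)

↭-unshift : ∀ k → r ↭ map (k +_) τ → ∃ λ τ′ → r ≡ map (k +_) τ′ × τ′ ↭ τ
↭-unshift {r} {τ} k p = map (_∸ k) r , sym r≡ , τ′↭τ
  where
  k≤r : All (k ≤_) r
  k≤r = All-resp-↭ (↭-sym p) (All.map⁺ (All.tabulate (λ {x} _ → m≤m+n k x)))
  r≡ : map (k +_) (map (_∸ k) r) ≡ r
  r≡ = trans (sym (map-∘ r)) (map-id-local (All.map m+[n∸m]≡n k≤r))
  τ′↭τ : map (_∸ k) r ↭ τ
  τ′↭τ = subst (map (_∸ k) r ↭_) (trans (sym (map-∘ τ)) (map-id-local (All.tabulate (λ {x} _ → m+n∸m≡n k x))))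
               (↭.map⁺ (_∸ k) p)

perm-suffix : ∀ k → u ↭ inc k → u ++ r ↭ inc (k + n) →
              ∃ λ τ → r ≡ map (k +_) τ × τ ↭ inc n
perm-suffix {u} {r} {n} k u↭ p = ↭-unshift k (++-cancelˡ (inc k) suffix)
  where
  suffix : inc k ++ r ↭ inc k ++ map (k +_) (inc n)
  suffix = ↭-trans (++⁺ʳ r (↭-sym u↭))
             (subst (λ m → u ++ r ↭ inc k ++ map (m +_) (inc n)) (length-inc k)
                    (subst (u ++ r ↭_) (inc-+ k n) p))

FirstNotLeast : Perm → Set
FirstNotLeast []      = ⊥
FirstNotLeast (x ∷ q) = Any (_< x) q

A₂-firstNotLeast : All FirstNotLeast A₂
A₂-firstNotLeast = there (here (s<s z<s)) ∷ here (s<s (s<s z<s)) ∷ here (s<s z<s) ∷ here (s<s z<s) ∷ []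

Av-prepend-below : ∀ {S m} → All FirstNotLeast S → All (m ≤_) v → Av S v → Av S (m ∷ v)
Av-prepend-below []                   _   []          = []
Av-prepend-below {S = [] ∷ _} (() ∷ _)
Av-prepend-below {S = (_ ∷ _) ∷ _} (first ∷ firsts) m≤v (¬c ∷ ¬cs) =
  prepend-below m≤v first ¬c ∷ Av-prepend-below firsts m≤v ¬cs

map-suc-positive : ∀ v → All (1 ≤_) (map suc v)
map-suc-positive v = All.map⁺ (All.tabulate (λ _ → z<s))

Av-A₂-inc⊕ : ∀ k → Av A₂ v → Av A₂ (inc k ⊕ v)
Av-A₂-inc⊕ {v} zero    av = subst (Av A₂) (sym (⊕-identityˡ v)) av
Av-A₂-inc⊕ {v} (suc k) av =
  subst (Av A₂) (sym (inc-suc-⊕ k v))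
        (Av-prepend-below A₂-firstNotLeast (map-suc-positive _) (Av-map⁺ suc s<s (Av-A₂-inc⊕ k av)))

Fibonacci⇒Av-A₂ : Fibonacci τ → Av A₂ τ
Fibonacci⇒Av-A₂ {τ} (_ , ¬231 ∷ ¬312 ∷ ¬321 ∷ []) = ¬231 ∷ ¬321 ∷ ¬4123 ∷ ¬21534 ∷ []
  where
  ¬4123 : ¬ Contains τ p4123
  ¬4123 occ with b ∷ c ∷ d ∷ a ∷ [] , b<c ∷ c<d ∷ d<a ∷ [-] , sub ← occurrence4123 occ =
    ¬312 (occurrence⇒contains (b ∷ d ∷ a ∷ [] , <-trans b<c c<d ∷ d<a ∷ [-] ,
                               ⊆-trans (refl ∷ refl ∷ c ∷ʳ refl ∷ []) sub))
  ¬21534 : ¬ Contains τ p21534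
  ¬21534 occ with b ∷ a ∷ d ∷ e ∷ c ∷ [] , _ ∷ _ ∷ d<e ∷ e<c ∷ [-] , sub ← occurrence21534 occ =
    ¬312 (occurrence⇒contains (d ∷ e ∷ c ∷ [] , d<e ∷ e<c ∷ [-] , ∷ˡ⁻ (∷ˡ⁻ sub)))

entries-below-3-ascend : ∀ {R x y} → All (3 <_) R → (x ∷ y ∷ []) ⊆ 1 ∷ 2 ∷ R → y < 3 → x < y
entries-below-3-ascend 3<R (refl ∷ refl ∷ _)     _   = s<s z<s
entries-below-3-ascend 3<R (refl ∷ _ ∷ʳ y⊆R)     y<3 = ⊥-elim (<-asym y<3 (All.head (All-resp-⊆ y⊆R 3<R)))
entries-below-3-ascend 3<R (_ ∷ʳ refl ∷ y⊆R)     y<3 = ⊥-elim (<-asym y<3 (All.head (All-resp-⊆ y⊆R 3<R)))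
entries-below-3-ascend 3<R (_ ∷ʳ _ ∷ʳ xy⊆R)      y<3 = ⊥-elim (<-asym y<3 (All.head (All-resp-⊆ (∷ˡ⁻ xy⊆R) 3<R)))

entries-above-2-in-tail : ∀ {R x xs} → (x ∷ xs) ⊆ 1 ∷ 2 ∷ R → 2 < x → (x ∷ xs) ⊆ R
entries-above-2-in-tail (refl ∷ _)       (s≤s ())
entries-above-2-in-tail (_ ∷ʳ refl ∷ _)  (s≤s (s≤s ()))
entries-above-2-in-tail (_ ∷ʳ _ ∷ʳ sub) _ = sub

Av-A₂-312-block : ∀ {R} → All (3 <_) R → ¬ Contains R p312 → Av A₂ (1 ∷ 2 ∷ R) → Av A₂ (3 ∷ 1 ∷ 2 ∷ R)
Av-A₂-312-block {R} 3<R ¬312R (¬231′ ∷ ¬321′ ∷ ¬4123′ ∷ ¬21534′ ∷ []) = ¬231 ∷ ¬321 ∷ ¬4123 ∷ ¬21534 ∷ []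
  where
  positive : All (1 ≤_) (1 ∷ 2 ∷ R)
  positive = s≤s z≤n ∷ s≤s z≤n ∷ All.map (≤-trans (s≤s z≤n) ∘ <⇒≤) 3<R

  ¬231 : ¬ Contains (3 ∷ 1 ∷ 2 ∷ R) p231
  ¬231 occ with occurrence231 occ
  ... | vs , vs< , _ ∷ʳ sub = ¬231′ (occurrence⇒contains (vs , vs< , sub))
  ... | c ∷ _ ∷ b ∷ [] , c<3 ∷ 3<b ∷ [-] , refl ∷ sub =
    <-asym (<-trans c<3 3<b) (entries-below-3-ascend 3<R sub c<3)

  ¬321 : ¬ Contains (3 ∷ 1 ∷ 2 ∷ R) p321
  ¬321 occ with occurrence321 occ
  ... | vs , vs< , _ ∷ʳ sub = ¬321′ (occurrence⇒contains (vs , vs< , sub))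
  ... | c ∷ b ∷ _ ∷ [] , c<b ∷ b<3 ∷ [-] , refl ∷ sub =
    <-asym c<b (entries-below-3-ascend 3<R sub (<-trans c<b b<3))

  ¬4123 : ¬ Contains (3 ∷ 1 ∷ 2 ∷ R) p4123
  ¬4123 occ with occurrence4123 occ
  ... | vs , vs< , _ ∷ʳ sub = ¬4123′ (occurrence⇒contains (vs , vs< , sub))
  ... | b ∷ c ∷ d ∷ _ ∷ [] , b<c ∷ c<d ∷ d<3 ∷ [-] , refl ∷ sub =
    <⇒≱ d<3 (≤-trans (s≤s (≤-trans (s≤s 1≤b) b<c)) c<d)
    where
    1≤b : 1 ≤ b
    1≤b = All.head (All-resp-⊆ sub positive)

  ¬21534 : ¬ Contains (3 ∷ 1 ∷ 2 ∷ R) p21534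
  ¬21534 occ with occurrence21534 occ
  ... | vs , vs< , _ ∷ʳ sub = ¬21534′ (occurrence⇒contains (vs , vs< , sub))
  ... | _ ∷ _ ∷ d ∷ e ∷ c ∷ [] , _ ∷ 3<d ∷ d<e ∷ e<c ∷ [-] , refl ∷ sub =
    ¬312R (occurrence⇒contains (d ∷ e ∷ c ∷ [] , d<e ∷ e<c ∷ [-] ,
             entries-above-2-in-tail (∷ˡ⁻ sub) (<⇒≤ (<-trans 3<d (<-trans d<e e<c)))))

Av-A₂-312⊕ : Fibonacci τ → Av A₂ (p312 ⊕ τ)
Av-A₂-312⊕ {τ} fib@(perm , _ ∷ ¬312 ∷ _ ∷ []) =
  Av-A₂-312-block 3<R (¬312 ∘ Contains-map⁻ (3 +_) (+-monoʳ-< 3))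
    (Av-prepend-below A₂-firstNotLeast (s≤s z≤n ∷ All.map (≤-trans (s≤s z≤n) ∘ <⇒≤) 3<R)
      (Av-prepend-below A₂-firstNotLeast (All.map (≤-trans (s≤s (s≤s z≤n)) ∘ <⇒≤) 3<R)
        (Av-map⁺ (3 +_) (+-monoʳ-< 3) (Fibonacci⇒Av-A₂ fib))))
  where
  3<R : All (3 <_) (map (3 +_) τ)
  3<R = All.map⁺ (All.map (m<m+n 3) (perm-positive perm))

Decomposition : Perm → Set
Decomposition w = Σ ℕ λ k → Σ Perm λ σ → Σ Perm λ τ →
                    ((σ ≡ []) ⊎ (σ ≡ p312)) × Fibonacci τ × (w ≡ inc k ⊕ σ ⊕ τ)

Decomposition⇒Av-A₂ : Decomposition w → Av A₂ w
Decomposition⇒Av-A₂ (k , σ , τ , σ≡ , fib , refl) =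
  subst (Av A₂) (sym (⊕-assoc (inc k) σ τ)) (Av-A₂-inc⊕ k (middle σ≡))
  where
  middle : (σ ≡ []) ⊎ (σ ≡ p312) → Av A₂ (σ ⊕ τ)
  middle (inj₁ refl) = subst (Av A₂) (sym (⊕-identityˡ τ)) (Fibonacci⇒Av-A₂ fib)
  middle (inj₂ refl) = Av-A₂-312⊕ fib

-- Otherwise x y m is a 231 or a 321.
second-entry-≤ : ∀ {y m} → x ≢ y → ¬ Contains (x ∷ y ∷ r) p231 → ¬ Contains (x ∷ y ∷ r) p321 →
                 m ∈ y ∷ r → m < x → y ≤ m
second-entry-≤ _ _ _ (here refl) _ = ≤-refl
second-entry-≤ {x = x} {y = y} {m = m} x≢y ¬231 ¬321 (there m∈r) m<x with y ≤? m
... | yes y≤m = y≤m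
... | no y≰m with <-cmp x y
...   | tri< x<y _ _ =
  ⊥-elim (¬231 (occurrence⇒contains (m ∷ x ∷ y ∷ [] , m<x ∷ x<y ∷ [-] , refl ∷ refl ∷ from∈ m∈r)))
...   | tri≈ _ x≡y _ = ⊥-elim (x≢y x≡y)
...   | tri> _ _ y<x =
  ⊥-elim (¬321 (occurrence⇒contains (m ∷ y ∷ x ∷ [] , ≰⇒> y≰m ∷ y<x ∷ [-] , refl ∷ refl ∷ from∈ m∈r)))

below-first-later : ∀ {m} → IsPerm (x ∷ r) → 1 ≤ m → m < x → m ∈ r
below-first-later perm 1≤m m<x =
  Any.tail (λ { refl → <-irrefl refl m<x }) (perm-downward perm (here refl) 1≤m (<⇒≤ m<x))

second-is-1 : IsPerm (x ∷ r) → 2 ≤ x → ¬ Contains (x ∷ r) p231 → ¬ Contains (x ∷ r) p321 →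
              ∃ λ r′ → r ≡ 1 ∷ r′
second-is-1 {r = []} perm 2≤x _ _ with () ← below-first-later perm ≤-refl 2≤x
second-is-1 {x} {y ∷ r′} perm 2≤x ¬231 ¬321 = r′ , cong (_∷ r′) (≤-antisym y≤1 1≤y)
  where
  x≢y : x ≢ y
  x≢y with (x≢y ∷ _) ∷ _ ← perm-unique perm = x≢y
  y≤1 : y ≤ 1
  y≤1 = second-entry-≤ x≢y ¬231 ¬321 (below-first-later perm ≤-refl 2≤x) 2≤x
  1≤y : 1 ≤ y
  1≤y = All.head (All.tail (perm-positive perm))

third-is-2 : IsPerm (x ∷ 1 ∷ r) → 3 ≤ x → ¬ Contains (x ∷ 1 ∷ r) p231 → ¬ Contains (x ∷ 1 ∷ r) p321 →
             ∃ λ r′ → r ≡ 2 ∷ r′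
third-is-2 {r = []} perm 3≤x _ _ with () ← Any.tail (λ ()) (below-first-later perm (s≤s z≤n) 3≤x)
third-is-2 {x} {z ∷ r′} perm 3≤x ¬231 ¬321 = r′ , cong (_∷ r′) (≤-antisym z≤2 (≤∧≢⇒< 1≤z 1≢z))
  where
  drop-1 : (x ∷ z ∷ r′) ⊆ (x ∷ 1 ∷ z ∷ r′)
  drop-1 = refl ∷ 1 ∷ʳ ⊆-refl
  x≢z : x ≢ z
  x≢z with (_ ∷ x≢z ∷ _) ∷ _ ← perm-unique perm = x≢z
  1≢z : 1 ≢ z
  1≢z with _ ∷ (1≢z ∷ _) ∷ _ ← perm-unique perm = 1≢z
  z≤2 : z ≤ 2
  z≤2 = second-entry-≤ x≢z (¬231 ∘ Contains-resp-⊆ drop-1) (¬321 ∘ Contains-resp-⊆ drop-1)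
          (Any.tail (λ ()) (below-first-later perm (s≤s z≤n) 3≤x)) 3≤x
  1≤z : 1 ≤ z
  1≤z = All.head (All.tail (All.tail (perm-positive perm)))

first-is-3 : IsPerm (x ∷ 1 ∷ 2 ∷ r) → 3 ≤ x → ¬ Contains (x ∷ 1 ∷ 2 ∷ r) p4123 → x ≡ 3
first-is-3 {x} {r} perm 3≤x ¬4123 = ≤-antisym (≮⇒≥ (¬4123 ∘ x123-is-4123)) 3≤x
  where
  x123-is-4123 : 3 < x → Contains (x ∷ 1 ∷ 2 ∷ r) p4123
  x123-is-4123 3<x = occurrence⇒contains (1 ∷ 2 ∷ 3 ∷ x ∷ [] , s<s z<s ∷ s<s (s<s z<s) ∷ 3<x ∷ [-] ,
                                          refl ∷ refl ∷ refl ∷ from∈ 3∈r)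
    where
    3∈r : 3 ∈ r
    3∈r = Any.tail (λ ()) (Any.tail (λ ()) (below-first-later perm (s≤s z≤n) 3<x))

-- A 312 occurrence a b c in R extends to the 21534 occurrence x y a b c.
¬312-after-descent : ∀ {x y R} → y < x → All (x <_) R → ¬ Contains (x ∷ y ∷ R) p21534 → ¬ Contains R p312
¬312-after-descent {x} y<x x<R ¬21534 occ with b ∷ c ∷ a ∷ [] , b<c ∷ c<a ∷ [-] , sub ← occurrence312 occ =
  ¬21534 (occurrence⇒contains (_ ∷ _ ∷ b ∷ c ∷ a ∷ [] , y<x ∷ x<b ∷ b<c ∷ c<a ∷ [-] , refl ∷ refl ∷ sub))
  where
  x<b : x < b
  x<b = All.head (All.tail (All-resp-⊆ sub x<R))

starts-with-21 : IsPerm (2 ∷ 1 ∷ r) → Av A₂ (2 ∷ 1 ∷ r) → Decomposition (2 ∷ 1 ∷ r)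
starts-with-21 {r} perm (¬231 ∷ ¬321 ∷ _ ∷ ¬21534 ∷ []) =
  0 , [] , 2 ∷ 1 ∷ r , inj₁ refl , (perm , ¬231 ∷ ¬312 ∷ ¬321 ∷ []) , sym (⊕-identityˡ _)
  where
  2<r : All (2 <_) r
  2<r with τ , refl , τ↭ ← perm-suffix 2 (swap 2 1 ↭-refl) perm =
    All.map⁺ (All.map (m<m+n 2) (perm-positive τ↭))
  ¬312-1∷r : ¬ Contains (1 ∷ r) p312
  ¬312-1∷r = prepend-below (All.tail (All.tail (perm-positive perm))) (here (s<s z<s))
               (¬312-after-descent (s<s z<s) 2<r ¬21534)
  ¬312 : ¬ Contains (2 ∷ 1 ∷ r) p312
  ¬312 occ with occurrence312 occ
  ... | vs , vs< , _ ∷ʳ sub = ¬312-1∷r (occurrence⇒contains (vs , vs< , sub))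
  ... | b ∷ c ∷ _ ∷ [] , b<c ∷ c<2 ∷ [-] , refl ∷ sub = <⇒≱ c<2 (≤-trans (s≤s 1≤b) b<c)
    where
    1≤b : 1 ≤ b
    1≤b = All.head (All-resp-⊆ sub (All.tail (perm-positive perm)))

starts-with-312 : IsPerm (3 ∷ 1 ∷ 2 ∷ r) → Av A₂ (3 ∷ 1 ∷ 2 ∷ r) → Decomposition (3 ∷ 1 ∷ 2 ∷ r)
starts-with-312 perm av@(_ ∷ _ ∷ _ ∷ ¬21534 ∷ [])
  with τ , refl , τ↭ ← perm-suffix 3 (↭-trans (swap 3 1 ↭-refl) (prep 1 (swap 3 2 ↭-refl))) perm =
  0 , p312 , τ , inj₂ refl , (perm-isPerm τ↭ , ¬231 ∷ ¬312 ∷ ¬321 ∷ []) , refl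
  where
  3<R : All (3 <_) (map (3 +_) τ)
  3<R = All.map⁺ (All.map (m<m+n 3) (perm-positive τ↭))
  av-τ : Av A₂ τ
  av-τ = Av-map⁻ (3 +_) (+-monoʳ-< 3) (Av-resp-⊇ (3 ∷ʳ 1 ∷ʳ 2 ∷ʳ ⊆-refl) av)
  ¬231 : ¬ Contains τ p231
  ¬231 = All.head av-τ
  ¬321 : ¬ Contains τ p321
  ¬321 = All.head (All.tail av-τ)
  ¬312 : ¬ Contains τ p312
  ¬312 = ¬312-after-descent (s<s z<s) 3<R (¬21534 ∘ Contains-resp-⊆ (refl ∷ refl ∷ 2 ∷ʳ ⊆-refl))
       ∘ Contains-map⁺ (3 +_) (+-monoʳ-< 3)

starts-with-2 : IsPerm (2 ∷ r) → Av A₂ (2 ∷ r) → Decomposition (2 ∷ r)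
starts-with-2 perm av@(¬231 ∷ ¬321 ∷ _)
  with r′ , refl ← second-is-1 perm ≤-refl ¬231 ¬321 = starts-with-21 perm av

starts-above-2 : IsPerm (x ∷ r) → 3 ≤ x → Av A₂ (x ∷ r) → Decomposition (x ∷ r)
starts-above-2 perm 3≤x av@(¬231 ∷ ¬321 ∷ ¬4123 ∷ _)
  with r′ , refl ← second-is-1 perm (<⇒≤ 3≤x) ¬231 ¬321
  with r″ , refl ← third-is-2 perm 3≤x ¬231 ¬321
  with refl ← first-is-3 perm 3≤x ¬4123 = starts-with-312 perm av

Decomposition-inc1⊕ : Decomposition v → Decomposition (inc 1 ⊕ v)
Decomposition-inc1⊕ (k , σ , τ , σ≡ , fib , refl) = suc k , σ , τ , σ≡ , fib , (begin
  inc 1 ⊕ (inc k ⊕ σ ⊕ τ)   ≡⟨ cong (inc 1 ⊕_) (⊕-assoc (inc k) σ τ) ⟩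
  inc 1 ⊕ (inc k ⊕ (σ ⊕ τ)) ≡⟨ sym (inc-suc-⊕ k (σ ⊕ τ)) ⟩
  inc (suc k) ⊕ (σ ⊕ τ)     ≡⟨ sym (⊕-assoc (inc (suc k)) σ τ) ⟩
  inc (suc k) ⊕ σ ⊕ τ       ∎)
  where open ≡-Reasoning

¬Contains-[] : ∀ {x q} → ¬ Contains [] (x ∷ q)
¬Contains-[] (_ , [] , () , _)

decompose : ∀ n {w} → w ↭ inc n → Av A₂ w → Decomposition w
decompose _       {[]}    _ _ =
  0 , [] , [] , inj₁ refl , (↭-refl , ¬Contains-[] ∷ ¬Contains-[] ∷ ¬Contains-[] ∷ []) , refl
decompose zero    {_ ∷ _} perm _ = ⊥-elim (¬x∷xs↭[] perm)
decompose (suc n) {0 ∷ _} perm _ with () ← All.head (perm-positive perm)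
decompose (suc n) {1 ∷ r} perm av with τ , refl , τ↭ ← perm-suffix 1 ↭-refl perm =
  Decomposition-inc1⊕ (decompose n τ↭ (Av-map⁻ suc s<s (Av-resp-⊇ (1 ∷ʳ ⊆-refl) av)))
decompose (suc n) {2 ∷ r} perm av = starts-with-2 (perm-isPerm perm) av
decompose (suc n) {suc (suc (suc _)) ∷ r} perm av =
  starts-above-2 (perm-isPerm perm) (s≤s (s≤s (s≤s z≤n))) av

theorem2p3 : (w : Perm) → IsPerm w →
    Av A₂ w ⇔
      (Σ ℕ λ k → Σ Perm λ σ → Σ Perm λ τ →
        ((σ ≡ []) ⊎ (σ ≡ p312)) × Fibonacci τ × (w ≡ inc k ⊕ σ ⊕ τ))
theorem2p3 w perm = mk⇔ (decompose (length w) perm) Decomposition⇒Av-A₂
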